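{- For integers $\alpha\ge 0$ and $k\ge 1$, $$F(\alpha,1,k)=\alpha\, I_1(4k-1)+2(4k-1)(2k-1)\,I_1(4k-3).$$
   Context: For $n\ge 0$, $I_1(n)$ denotes the number of involutions in the symmetric group $\mathfrak{S}_n$ (with $I_1(0)=1$). For integers $\alpha,\beta\ge 0$ and $k\ge 1$, define $$F(\alpha,\beta,k)=\sum_{j=0}^{2k-1}(2j+\alpha)^{\beta}\,\frac{(2j)!}{j!\,2^j}\binom{4k-1}{2j}.$$ -}

module Defs where

open import Data.Nat using (ℕ; zero; suc; _+_; _*_; _∸_; _^_; _/_; _!; NonZero)
open import Data.Nat.Properties using (m*n≢0; m^n≢0; _!≢0)
open import Data.Nat.Combinatorics using (_C_)
open import Relation.Nullary using (Dec)
open import Data.Fin using (Fin)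
open import Data.Fin.Properties using (_≟_)
open import Data.Vec using (Vec; []; _∷_; lookup; allFin)
import Data.List
open import Data.List using (List; []; _∷_; map; concatMap; length; filter; upTo)
open import Data.Nat.ListAction using (sum)
open import Data.Vec.Relation.Unary.All using (All)
open import Data.Vec.Relation.Unary.All using (all?)
open import Relation.Binary.PropositionalEquality using (_≡_)

allVecs : (n m : ℕ) → List (Vec (Fin n) m)
allVecs n zero = [] ∷ []
allVecs n (suc m) = concatMap (λ v → map (λ i → i ∷ v) (Data.List.allFin n)) (allVecs n m)

-- f : Fin n → Fin n (as a table) is an involution iff f (f x) ≡ x for all x;
-- such f is automatically a bijection, i.e. an element of S_n with f² = id.
IsInvolution : {n : ℕ} → Vec (Fin n) n → Set
IsInvolution {n} f = All (λ x → lookup f (lookup f x) ≡ x) (allFin n)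

isInvolution? : {n : ℕ} (f : Vec (Fin n) n) → Dec (IsInvolution f)
isInvolution? {n} f = all? (λ x → lookup f (lookup f x) ≟ x) (allFin n)

I₁ : ℕ → ℕ
I₁ n = length (filter isInvolution? (allVecs n n))

-- F(α, β, k) = Σ_{j=0}^{2k-1} (2j+α)^β (2j)!/(j! 2^j) C(4k-1, 2j)
-- (2j)!/(j! 2^j) is an exact integer (double factorial (2j-1)!!).
F : ℕ → ℕ → ℕ → ℕ
F α β k = sum (map term (upTo (2 * k)))
  where
    term : ℕ → ℕ
    term j = ((2 * j + α) ^ β) * (((2 * j) ! / ((j !) * 2 ^ j)) {{nz j}}) * ((4 * k ∸ 1) C (2 * j))
      where
        nz : (j : ℕ) → NonZero ((j !) * 2 ^ j)
        nz j = m*n≢0 (j !) (2 ^ j) {{j !≢0}} {{m^n≢0 2 j}}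

module Submission where

-- Every involution of Fin (n + 2) either fixes 0 or pairs 0 with one of the other n + 1 points;
-- an explicit duplicate-free enumeration along this split gives I₁ (n + 2) = I₁ (n + 1) + (n + 1) I₁ n,
-- and with it the closed form I₁ n = Σⱼ (2j − 1)!! C(n, 2j) counting involutions by their number of
-- two-cycles. Since (2j)! / (j! 2ʲ) = (2j − 1)!!, the summand of F α 1 k is (2j + α) times the j-th term
-- of I₁ (4k − 1). The α-part sums to α I₁ (4k − 1), and the absorption identity
-- 2j (2j − 1)!! C(N, 2j) = N (N − 1) (2j − 3)!! C(N − 2, 2j − 2) turns the 2j-part into
-- N (N − 1) I₁ (N − 2) with N = 4k − 1, i.e. 2 (4k − 1)(2k − 1) I₁ (4k − 3).

open import Defs
open import Algebra.Definitions using (Involutive)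
open import Data.Nat using (ℕ; zero; suc; _+_; _*_; _∸_; _^_; _!; _/_; _≤_; _<_; NonZero)
open import Data.Nat.Properties
  using (*-suc; *-zeroʳ; *-identityˡ; *-identityʳ; +-assoc; *-distribˡ-+; ≤-pred; m≤n⇒m≤1+n; ≤-reflexive;
         m*n≢0; m^n≢0; _!≢0)
open import Data.Nat.Combinatorics using (_C_; nC1≡n; nCk+nC[k+1]≡[n+1]C[k+1])
open import Data.Nat.DivMod using (m*n/n≡m)
open import Data.Nat.ListAction using (sum)
open import Data.Nat.Tactic.RingSolver using (solve-∀)
open import Data.Fin using (Fin; zero; suc)
open import Data.Fin.Properties using (suc-injective)
open import Data.Fin.Permutation.Components using (transpose; transpose-inverse)
open import Data.Vec using (Vec; []; _∷_; lookup; tabulate)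
import Data.Vec as Vec
open import Data.Vec.Properties using (lookup∘tabulate; tabulate∘lookup; tabulate-cong; lookup-allFin; ∷-injectiveˡ)
import Data.Vec.Relation.Unary.All.Properties as All
import Data.List as List
open import Data.List using (List; []; _∷_; map; concatMap; length; applyUpTo)
open import Data.List.Properties using (length-++; length-map; map-applyUpTo)
open import Data.List.Membership.Propositional using (_∈_; find)
open import Data.List.Membership.Propositional.Properties
  using (∈-map⁺; ∈-map⁻; ∈-concatMap⁺; ∈-concatMap⁻; ∈-allFin; ∈-filter⁺; ∈-filter⁻)
open import Data.List.Membership.Propositional.Properties.WithK using (unique∧set⇒bag)
open import Data.List.Relation.Binary.BagAndSetEquality using (_∼[_]_; set; ∼bag⇒↭)
open import Data.List.Relation.Binary.Permutation.Propositional.Properties using (↭-length)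
open import Data.List.Relation.Unary.Any as Any using (here)
import Data.List.Relation.Unary.All as ListAll
open import Data.List.Relation.Unary.AllPairs using ([]; _∷_)
open import Data.List.Relation.Unary.Unique.Propositional using (Unique)
import Data.List.Relation.Unary.Unique.Propositional.Properties as Unique
open import Data.Product using (∃; _×_; _,_; proj₁; proj₂)
open import Function using (_∘_; id)
open import Function.Bundles using (_⇔_; mk⇔; Equivalence)
open import Relation.Binary.PropositionalEquality
  using (_≡_; _≗_; refl; sym; trans; cong; cong₂; subst; module ≡-Reasoning)
open import Relation.Nullary using (contradiction)

private variable A B : Set

unique∧set⇒length≡ : {xs ys : List A} → Unique xs → Unique ys → xs ∼[ set ] ys → length xs ≡ length ys
unique∧set⇒length≡ xs! ys! xs∼ys = ↭-length (∼bag⇒↭ (unique∧set⇒bag xs! ys! xs∼ys))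

concatMap-unique : (key : B → A) {f : A → List B} {xs : List A} →
                   (∀ {x y} → y ∈ f x → key y ≡ x) → (∀ x → Unique (f x)) → Unique xs →
                   Unique (concatMap f xs)
concatMap-unique key keyed f! [] = []
concatMap-unique key {f} keyed f! (x∉xs ∷ xs!) =
  Unique.++⁺ (f! _) (concatMap-unique key keyed f! xs!) λ (y∈fx , y∈rest) →
    let x' , x'∈xs , y∈fx' = find (∈-concatMap⁻ f y∈rest)
    in  ListAll.lookup x∉xs x'∈xs (trans (sym (keyed y∈fx)) (keyed y∈fx'))

length-concatMap-tabulate : ∀ {n} (f : A → List B) (g : Fin n → A) {c} → (∀ i → length (f (g i)) ≡ c) →
                            length (concatMap f (List.tabulate g)) ≡ n * c
length-concatMap-tabulate {n = zero} f g _ = refl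
length-concatMap-tabulate {n = suc n} f g lengths = trans (length-++ (f (g zero)))
  (cong₂ _+_ (lengths zero) (length-concatMap-tabulate f (g ∘ suc) (lengths ∘ suc)))

tabulate-≗ : ∀ {n} {v : Vec A n} {f : Fin n → A} → lookup v ≗ f → tabulate f ≡ v
tabulate-≗ {v = v} v≗f = trans (sym (tabulate-cong v≗f)) (tabulate∘lookup v)

lookup-injective : ∀ {n} {u v : Vec A n} → lookup u ≗ lookup v → u ≡ v
lookup-injective {v = v} u≗v = trans (sym (tabulate-≗ u≗v)) (tabulate∘lookup v)

tabulate-injective : ∀ {n} {f g : Fin n → A} → tabulate f ≡ tabulate g → f ≗ g
tabulate-injective {f = f} {g} eq i =
  trans (sym (lookup∘tabulate f i)) (trans (cong (λ v → lookup v i) eq) (lookup∘tabulate g i))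

tabulate∘lookup-injective : ∀ {m n} (h : (Fin m → A) → Fin n → B) → (∀ {f g} → h f ≗ h g → f ≗ g) →
                            ∀ {u v} → tabulate (h (lookup u)) ≡ tabulate (h (lookup v)) → u ≡ v
tabulate∘lookup-injective h h-injective {u} {v} eq =
  lookup-injective (h-injective (tabulate-injective {f = h (lookup u)} {h (lookup v)} eq))

allVecs-unique : ∀ n m → Unique (allVecs n m)
allVecs-unique n zero = ListAll.[] ∷ []
allVecs-unique n (suc m) =
  concatMap-unique Vec.tail tail-cons (λ _ → Unique.map⁺ ∷-injectiveˡ (Unique.allFin⁺ n)) (allVecs-unique n m)
  where
  tail-cons : ∀ {v w} → w ∈ map (_∷ v) (List.allFin n) → Vec.tail w ≡ v
  tail-cons w∈ with ∈-map⁻ _ w∈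
  ... | _ , _ , refl = refl

∈-allVecs : ∀ n m (v : Vec (Fin n) m) → v ∈ allVecs n m
∈-allVecs n zero [] = here refl
∈-allVecs n (suc m) (i ∷ v) = ∈-concatMap⁺ (λ w → map (_∷ w) (List.allFin n))
  (Any.map (λ { refl → ∈-map⁺ (_∷ v) (∈-allFin i) }) (∈-allVecs n m v))

IsInvolution⇔Involutive : ∀ {n} (v : Vec (Fin n) n) → IsInvolution v ⇔ Involutive _≡_ (lookup v)
IsInvolution⇔Involutive {n} v = mk⇔
  (λ p i → subst (λ x → lookup v (lookup v x) ≡ x) (lookup-allFin i) (All.lookup⁺ p i))
  (λ p → All.lookup⁻ (λ i → p (lookup (Vec.allFin n) i)))

I₁≡length : ∀ n {xs : List (Vec (Fin n) n)} → Unique xs →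
            (∀ {v} → v ∈ xs ⇔ Involutive _≡_ (lookup v)) → I₁ n ≡ length xs
I₁≡length n xs! xs⇔ = unique∧set⇒length≡ (Unique.filter⁺ isInvolution? (allVecs-unique n n)) xs! λ {v} → mk⇔
  (λ v∈ → from xs⇔ (to (IsInvolution⇔Involutive v) (proj₂ (∈-filter⁻ isInvolution? {xs = allVecs n n} v∈))))
  (λ v∈ → ∈-filter⁺ isInvolution? (∈-allVecs n n v) (from (IsInvolution⇔Involutive v) (to xs⇔ v∈)))
  where open Equivalence

involution-flip : (f : A → A) → Involutive _≡_ f → ∀ {x y} → f x ≡ y → f y ≡ x
involution-flip f inv {x} fx≡y = trans (cong f (sym fx≡y)) (inv x)

conjugate-involutive : (π π⁻¹ f : A → A) → (∀ x → π (π⁻¹ x) ≡ x) → (∀ x → π⁻¹ (π x) ≡ x) →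
                       Involutive _≡_ f → Involutive _≡_ (π ∘ f ∘ π⁻¹)
conjugate-involutive π π⁻¹ f ππ⁻¹ π⁻¹π inv x = begin
  π (f (π⁻¹ (π (f (π⁻¹ x))))) ≡⟨ cong (π ∘ f) (π⁻¹π (f (π⁻¹ x))) ⟩
  π (f (f (π⁻¹ x)))           ≡⟨ cong π (inv (π⁻¹ x)) ⟩
  π (π⁻¹ x)                   ≡⟨ ππ⁻¹ x ⟩
  x                           ∎
  where open ≡-Reasoning

Involutive-tabulate : ∀ {n} (f : Fin n → Fin n) → Involutive _≡_ f → Involutive _≡_ (lookup (tabulate f))
Involutive-tabulate f inv i =
  trans (cong (lookup (tabulate f)) (lookup∘tabulate f i)) (trans (lookup∘tabulate f (f i)) (inv i))

restrict-involution : ∀ {m k} (e : Fin m → Fin k) → (∀ {i j} → e i ≡ e j → i ≡ j) →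
                      (f : Fin k → Fin k) → Involutive _≡_ f → (∀ i → ∃ λ j → f (e i) ≡ e j) →
                      ∃ λ (w : Vec (Fin m) m) → Involutive _≡_ (lookup w) × (∀ i → f (e i) ≡ e (lookup w i))
restrict-involution e e-injective f inv closed = w , w-involutive , f∘e
  where
  w = tabulate (proj₁ ∘ closed)
  f∘e : ∀ i → f (e i) ≡ e (lookup w i)
  f∘e i = trans (proj₂ (closed i)) (cong e (sym (lookup∘tabulate (proj₁ ∘ closed) i)))
  w-involutive : Involutive _≡_ (lookup w)
  w-involutive i = e-injective (begin
    e (lookup w (lookup w i)) ≡⟨ sym (f∘e (lookup w i)) ⟩
    f (e (lookup w i))        ≡⟨ cong f (sym (f∘e i)) ⟩
    f (f (e i))               ≡⟨ inv (e i) ⟩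
    e i                       ∎)
    where open ≡-Reasoning

fixZero : ∀ {m} → (Fin m → Fin m) → Fin (suc m) → Fin (suc m)
fixZero f zero = zero
fixZero f (suc i) = suc (f i)

fixZero-involutive : ∀ {m} {f : Fin m → Fin m} → Involutive _≡_ f → Involutive _≡_ (fixZero f)
fixZero-involutive inv zero = refl
fixZero-involutive inv (suc i) = cong suc (inv i)

fixZero-injective : ∀ {m} {f g : Fin m → Fin m} → fixZero f ≗ fixZero g → f ≗ g
fixZero-injective f≗g i = suc-injective (f≗g (suc i))

fixZero-view : ∀ {m} (f : Fin (suc m) → Fin (suc m)) → Involutive _≡_ f → f zero ≡ zero →
               ∃ λ (w : Vec (Fin m) m) → Involutive _≡_ (lookup w) × f ≗ fixZero (lookup w)
fixZero-view f inv f0≡0 =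
  let w , w-involutive , f∘suc = restrict-involution suc suc-injective f inv closed
  in  w , w-involutive , λ { zero → f0≡0 ; (suc i) → f∘suc i }
  where
  closed : ∀ i → ∃ λ j → f (suc i) ≡ suc j
  closed i with f (suc i) in eq
  ... | zero = contradiction (trans (sym (involution-flip f inv eq)) f0≡0) λ ()
  ... | suc j = j , refl

swapZeroOne : ∀ {m} → (Fin m → Fin m) → Fin (suc (suc m)) → Fin (suc (suc m))
swapZeroOne f zero = suc zero
swapZeroOne f (suc zero) = zero
swapZeroOne f (suc (suc i)) = suc (suc (f i))

swapZeroOne-involutive : ∀ {m} {f : Fin m → Fin m} → Involutive _≡_ f → Involutive _≡_ (swapZeroOne f)
swapZeroOne-involutive inv zero = refl
swapZeroOne-involutive inv (suc zero) = refl
swapZeroOne-involutive inv (suc (suc i)) = cong (λ k → suc (suc k)) (inv i)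

swapZeroOne-injective : ∀ {m} {f g : Fin m → Fin m} → swapZeroOne f ≗ swapZeroOne g → f ≗ g
swapZeroOne-injective f≗g i = suc-injective (suc-injective (f≗g (suc (suc i))))

swapZeroOne-view : ∀ {m} (g : Fin (suc (suc m)) → Fin (suc (suc m))) → Involutive _≡_ g → g zero ≡ suc zero →
                   ∃ λ (w : Vec (Fin m) m) → Involutive _≡_ (lookup w) × g ≗ swapZeroOne (lookup w)
swapZeroOne-view g inv g0≡1 =
  let w , w-involutive , g∘suc² = restrict-involution (λ i → suc (suc i)) (suc-injective ∘ suc-injective) g inv closed
  in  w , w-involutive , λ { zero → g0≡1 ; (suc zero) → g1≡0 ; (suc (suc i)) → g∘suc² i }
  where
  g1≡0 = involution-flip g inv g0≡1
  closed : ∀ i → ∃ λ j → g (suc (suc i)) ≡ suc (suc j)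
  closed i with g (suc (suc i)) in eq
  ... | zero = contradiction (trans (sym (involution-flip g inv eq)) g0≡1) λ ()
  ... | suc zero = contradiction (trans (sym (involution-flip g inv eq)) g1≡0) λ ()
  ... | suc (suc j) = j , refl

module _ {m} (j : Fin (suc m)) where
  private
    π π⁻¹ : Fin (suc (suc m)) → Fin (suc (suc m))
    π = transpose (suc zero) (suc j)
    π⁻¹ = transpose (suc j) (suc zero)

    π∘π⁻¹ : ∀ x → π (π⁻¹ x) ≡ x
    π∘π⁻¹ _ = transpose-inverse (suc zero) (suc j)

    π⁻¹∘π : ∀ x → π⁻¹ (π x) ≡ x
    π⁻¹∘π _ = transpose-inverse (suc j) (suc zero)

  pairZeroWith : (Fin m → Fin m) → Fin (suc (suc m)) → Fin (suc (suc m))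
  pairZeroWith f = π ∘ swapZeroOne f ∘ π⁻¹

  pairZeroWith-involutive : ∀ {f} → Involutive _≡_ f → Involutive _≡_ (pairZeroWith f)
  pairZeroWith-involutive {f} inv =
    conjugate-involutive π π⁻¹ (swapZeroOne f) π∘π⁻¹ π⁻¹∘π (swapZeroOne-involutive inv)

  pairZeroWith-injective : ∀ {f g} → pairZeroWith f ≗ pairZeroWith g → f ≗ g
  pairZeroWith-injective {f} {g} f≗g = swapZeroOne-injective λ x → begin
    swapZeroOne f x                 ≡⟨ cong (swapZeroOne f) (π⁻¹∘π x) ⟨
    swapZeroOne f (π⁻¹ (π x))       ≡⟨ π⁻¹∘π _ ⟨
    π⁻¹ (pairZeroWith f (π x))      ≡⟨ cong π⁻¹ (f≗g (π x)) ⟩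
    π⁻¹ (pairZeroWith g (π x))      ≡⟨ π⁻¹∘π _ ⟩
    swapZeroOne g (π⁻¹ (π x))       ≡⟨ cong (swapZeroOne g) (π⁻¹∘π x) ⟩
    swapZeroOne g x                 ∎
    where open ≡-Reasoning

  pairZeroWith-view : (f : Fin (suc (suc m)) → Fin (suc (suc m))) → Involutive _≡_ f → f zero ≡ suc j →
                      ∃ λ (w : Vec (Fin m) m) → Involutive _≡_ (lookup w) × f ≗ pairZeroWith (lookup w)
  pairZeroWith-view f inv f0≡j =
    let w , w-involutive , g≗ = swapZeroOne-view (π⁻¹ ∘ f ∘ π)
                                  (conjugate-involutive π⁻¹ π f π⁻¹∘π π∘π⁻¹ inv)
                                  (trans (cong π⁻¹ f0≡j) (π⁻¹∘π (suc zero)))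
    in  w , w-involutive , λ x → begin
      f x                         ≡⟨ cong f (π∘π⁻¹ x) ⟨
      f (π (π⁻¹ x))               ≡⟨ π∘π⁻¹ _ ⟨
      π (π⁻¹ (f (π (π⁻¹ x))))     ≡⟨ cong π (g≗ (π⁻¹ x)) ⟩
      pairZeroWith (lookup w) x   ∎
    where open ≡-Reasoning

withZeroMappedTo : ∀ {n} → List (Vec (Fin (suc n)) (suc n)) → List (Vec (Fin n) n) →
                   Fin (suc (suc n)) → List (Vec (Fin (suc (suc n))) (suc (suc n)))
withZeroMappedTo vs ws zero = map (tabulate ∘ fixZero ∘ lookup) vs
withZeroMappedTo vs ws (suc j) = map (tabulate ∘ pairZeroWith j ∘ lookup) ws

module _ {n} {vs : List (Vec (Fin (suc n)) (suc n))} {ws : List (Vec (Fin n) n)} where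

  withZeroMappedTo-sound : (∀ {v} → v ∈ vs → Involutive _≡_ (lookup v)) →
                           (∀ {w} → w ∈ ws → Involutive _≡_ (lookup w)) →
                           ∀ i {u} → u ∈ withZeroMappedTo vs ws i → Involutive _≡_ (lookup u)
  withZeroMappedTo-sound vs-sound ws-sound zero u∈ with ∈-map⁻ _ u∈
  ... | v , v∈ , refl = Involutive-tabulate (fixZero (lookup v)) (fixZero-involutive (vs-sound v∈))
  withZeroMappedTo-sound vs-sound ws-sound (suc j) u∈ with ∈-map⁻ _ u∈
  ... | w , w∈ , refl = Involutive-tabulate (pairZeroWith j (lookup w)) (pairZeroWith-involutive j (ws-sound w∈))

  ∈-withZeroMappedTo : (∀ v → Involutive _≡_ (lookup v) → v ∈ vs) →
                       (∀ w → Involutive _≡_ (lookup w) → w ∈ ws) →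
                       ∀ u → Involutive _≡_ (lookup u) → u ∈ withZeroMappedTo vs ws (lookup u zero)
  ∈-withZeroMappedTo vs-complete ws-complete u inv with lookup u zero in u0
  ... | zero = let v , v-involutive , u≗ = fixZero-view (lookup u) inv u0 in
    subst (_∈ _) (tabulate-≗ u≗) (∈-map⁺ _ (vs-complete v v-involutive))
  ... | suc j = let w , w-involutive , u≗ = pairZeroWith-view j (lookup u) inv u0 in
    subst (_∈ _) (tabulate-≗ u≗) (∈-map⁺ _ (ws-complete w w-involutive))

  withZeroMappedTo-key : ∀ i {u} → u ∈ withZeroMappedTo vs ws i → lookup u zero ≡ i
  withZeroMappedTo-key zero u∈ with ∈-map⁻ _ u∈
  ... | v , _ , refl = lookup∘tabulate (fixZero (lookup v)) zero
  withZeroMappedTo-key (suc j) u∈ with ∈-map⁻ _ u∈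
  ... | w , _ , refl = lookup∘tabulate (pairZeroWith j (lookup w)) zero

  withZeroMappedTo-unique : Unique vs → Unique ws → ∀ i → Unique (withZeroMappedTo vs ws i)
  withZeroMappedTo-unique vs! ws! zero = Unique.map⁺ (tabulate∘lookup-injective fixZero fixZero-injective) vs!
  withZeroMappedTo-unique vs! ws! (suc j) =
    Unique.map⁺ (tabulate∘lookup-injective (pairZeroWith j) (pairZeroWith-injective j)) ws!

involutions : (n : ℕ) → List (Vec (Fin n) n)
involutions zero = [] ∷ []
involutions (suc zero) = (zero ∷ []) ∷ []
involutions (suc (suc n)) =
  concatMap (withZeroMappedTo (involutions (suc n)) (involutions n)) (List.allFin (suc (suc n)))

involutions-sound : ∀ n {v} → v ∈ involutions n → Involutive _≡_ (lookup v)
involutions-sound zero (here refl) ()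
involutions-sound (suc zero) (here refl) zero = refl
involutions-sound (suc (suc n)) v∈ =
  let i , _ , v∈ᵢ = find (∈-concatMap⁻ (withZeroMappedTo (involutions (suc n)) (involutions n)) {xs = List.allFin _} v∈)
  in  withZeroMappedTo-sound (involutions-sound (suc n)) (involutions-sound n) i v∈ᵢ

involutions-complete : ∀ n (v : Vec (Fin n) n) → Involutive _≡_ (lookup v) → v ∈ involutions n
involutions-complete zero [] _ = here refl
involutions-complete (suc zero) (zero ∷ []) _ = here refl
involutions-complete (suc (suc n)) v inv = ∈-concatMap⁺ block
  (Any.map (λ v0≡i → subst (λ i → v ∈ block i) v0≡i
                       (∈-withZeroMappedTo (involutions-complete (suc n)) (involutions-complete n) v inv))
           (∈-allFin (lookup v zero)))
  where block = withZeroMappedTo (involutions (suc n)) (involutions n)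

involutions-unique : ∀ n → Unique (involutions n)
involutions-unique zero = ListAll.[] ∷ []
involutions-unique (suc zero) = ListAll.[] ∷ []
involutions-unique (suc (suc n)) = concatMap-unique (λ u → lookup u zero) (withZeroMappedTo-key _)
  (withZeroMappedTo-unique (involutions-unique (suc n)) (involutions-unique n)) (Unique.allFin⁺ _)

length-involutions : ∀ n →
  length (involutions (suc (suc n))) ≡ length (involutions (suc n)) + suc n * length (involutions n)
length-involutions n = trans (length-++ (map _ (involutions (suc n))))
  (cong₂ _+_ (length-map _ (involutions (suc n)))
             (length-concatMap-tabulate (withZeroMappedTo (involutions (suc n)) (involutions n)) suc
                                        (λ _ → length-map _ (involutions n))))

I₁≡length-involutions : ∀ n → I₁ n ≡ length (involutions n)
I₁≡length-involutions n = I₁≡length n (involutions-unique n) (mk⇔ (involutions-sound n) (involutions-complete n _))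

I₁-recurrence : ∀ n → I₁ (suc (suc n)) ≡ I₁ (suc n) + suc n * I₁ n
I₁-recurrence n rewrite I₁≡length-involutions (suc (suc n)) | I₁≡length-involutions (suc n)
                      | I₁≡length-involutions n = length-involutions n

oddDoubleFactorial : ℕ → ℕ
oddDoubleFactorial zero = 1
oddDoubleFactorial (suc j) = suc (2 * j) * oddDoubleFactorial j

[2j]!≡oddDoubleFactorial*j!*2^j : ∀ j → (2 * j) ! ≡ oddDoubleFactorial j * (j ! * 2 ^ j)
[2j]!≡oddDoubleFactorial*j!*2^j zero = refl
[2j]!≡oddDoubleFactorial*j!*2^j (suc j) = begin
  (2 * suc j) !
    ≡⟨ cong _! (*-suc 2 j) ⟩
  suc (suc (2 * j)) * (suc (2 * j) * (2 * j) !)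
    ≡⟨ cong (λ x → suc (suc (2 * j)) * (suc (2 * j) * x)) ([2j]!≡oddDoubleFactorial*j!*2^j j) ⟩
  suc (suc (2 * j)) * (suc (2 * j) * (oddDoubleFactorial j * (j ! * 2 ^ j)))
    ≡⟨ regroup j (oddDoubleFactorial j) (j !) (2 ^ j) ⟩
  oddDoubleFactorial (suc j) * (suc j ! * 2 ^ suc j) ∎
  where
  open ≡-Reasoning
  regroup : ∀ j d f p → suc (suc (2 * j)) * (suc (2 * j) * (d * (f * p))) ≡ suc (2 * j) * d * ((suc j * f) * (2 * p))
  regroup = solve-∀

[2j]!/[j!*2^j]≡oddDoubleFactorial : ∀ j .{{_ : NonZero (j ! * 2 ^ j)}} →
                                    (2 * j) ! / (j ! * 2 ^ j) ≡ oddDoubleFactorial j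
[2j]!/[j!*2^j]≡oddDoubleFactorial j rewrite [2j]!≡oddDoubleFactorial*j!*2^j j =
  m*n/n≡m (oddDoubleFactorial j) (j ! * 2 ^ j)

[1+k]*[1+n]C[1+k]≡[1+n]*nCk : ∀ n k → suc k * (suc n C suc k) ≡ suc n * (n C k)
[1+k]*[1+n]C[1+k]≡[1+n]*nCk zero zero = refl
[1+k]*[1+n]C[1+k]≡[1+n]*nCk zero (suc k) = *-zeroʳ (suc (suc k))
[1+k]*[1+n]C[1+k]≡[1+n]*nCk (suc n) zero =
  trans (*-identityˡ _) (trans (nC1≡n (suc (suc n))) (sym (*-identityʳ _)))
[1+k]*[1+n]C[1+k]≡[1+n]*nCk (suc n) (suc k) = begin
  suc (suc k) * (suc (suc n) C suc (suc k))
    ≡⟨ cong (suc (suc k) *_) (nCk+nC[k+1]≡[n+1]C[k+1] (suc n) (suc k)) ⟨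
  suc (suc k) * (suc n C suc k + suc n C suc (suc k))
    ≡⟨ *-distribˡ-+ (suc (suc k)) (suc n C suc k) _ ⟩
  suc n C suc k + suc k * (suc n C suc k) + suc (suc k) * (suc n C suc (suc k))
    ≡⟨ cong₂ (λ x y → suc n C suc k + x + y) ([1+k]*[1+n]C[1+k]≡[1+n]*nCk n k)
                                            ([1+k]*[1+n]C[1+k]≡[1+n]*nCk n (suc k)) ⟩
  suc n C suc k + suc n * (n C k) + suc n * (n C suc k)
    ≡⟨ +-assoc (suc n C suc k) _ _ ⟩
  suc n C suc k + (suc n * (n C k) + suc n * (n C suc k))
    ≡⟨ cong (suc n C suc k +_) (*-distribˡ-+ (suc n) (n C k) _) ⟨
  suc n C suc k + suc n * (n C k + n C suc k)
    ≡⟨ cong (λ x → suc n C suc k + suc n * x) (nCk+nC[k+1]≡[n+1]C[k+1] n k) ⟩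
  suc (suc n) * (suc n C suc k) ∎
  where open ≡-Reasoning

-- the number of involutions of Fin n with exactly j two-cycles
matchingCount : ℕ → ℕ → ℕ
matchingCount n j = oddDoubleFactorial j * (n C (2 * j))

matchingCount-suc : ∀ n j →
  matchingCount n (suc j) ≡ suc (2 * j) * oddDoubleFactorial j * (n C suc (suc (2 * j)))
matchingCount-suc n j = cong (λ i → oddDoubleFactorial (suc j) * (n C i)) (*-suc 2 j)

matchingCount-recurrence : ∀ n j →
  matchingCount (suc (suc n)) (suc j) ≡ matchingCount (suc n) (suc j) + suc n * matchingCount n j
matchingCount-recurrence n j = begin
  matchingCount (suc (suc n)) (suc j)
    ≡⟨ matchingCount-suc (suc (suc n)) j ⟩
  suc (2 * j) * d * (suc (suc n) C suc (suc (2 * j)))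
    ≡⟨ cong (suc (2 * j) * d *_) (nCk+nC[k+1]≡[n+1]C[k+1] (suc n) (suc (2 * j))) ⟨
  suc (2 * j) * d * (suc n C suc (2 * j) + suc n C suc (suc (2 * j)))
    ≡⟨ expand (suc (2 * j)) d (suc n C suc (2 * j)) _ ⟩
  suc (2 * j) * d * (suc n C suc (suc (2 * j))) + d * (suc (2 * j) * (suc n C suc (2 * j)))
    ≡⟨ cong₂ (λ x y → x + d * y) (sym (matchingCount-suc (suc n) j)) ([1+k]*[1+n]C[1+k]≡[1+n]*nCk n (2 * j)) ⟩
  matchingCount (suc n) (suc j) + d * (suc n * (n C (2 * j)))
    ≡⟨ cong (matchingCount (suc n) (suc j) +_) (x[yz]≡y[xz] d (suc n) _) ⟩
  matchingCount (suc n) (suc j) + suc n * matchingCount n j ∎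
  where
  open ≡-Reasoning
  d = oddDoubleFactorial j
  expand : ∀ s d x y → s * d * (x + y) ≡ s * d * y + d * (s * x)
  expand = solve-∀
  x[yz]≡y[xz] : ∀ x y z → x * (y * z) ≡ y * (x * z)
  x[yz]≡y[xz] = solve-∀

[2+2j]*matchingCount≡[2+n]*[1+n]*matchingCount : ∀ n j →
  2 * suc j * matchingCount (suc (suc n)) (suc j) ≡ suc (suc n) * suc n * matchingCount n j
[2+2j]*matchingCount≡[2+n]*[1+n]*matchingCount n j = begin
  2 * suc j * matchingCount (suc (suc n)) (suc j)
    ≡⟨ cong₂ _*_ (*-suc 2 j) (matchingCount-suc (suc (suc n)) j) ⟩
  suc (suc (2 * j)) * (suc (2 * j) * d * (suc (suc n) C suc (suc (2 * j))))
    ≡⟨ regroup₁ (2 * j) d _ ⟩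
  d * suc (2 * j) * (suc (suc (2 * j)) * (suc (suc n) C suc (suc (2 * j))))
    ≡⟨ cong (d * suc (2 * j) *_) ([1+k]*[1+n]C[1+k]≡[1+n]*nCk (suc n) (suc (2 * j))) ⟩
  d * suc (2 * j) * (suc (suc n) * (suc n C suc (2 * j)))
    ≡⟨ regroup₂ d (suc (2 * j)) (suc (suc n)) _ ⟩
  suc (suc n) * d * (suc (2 * j) * (suc n C suc (2 * j)))
    ≡⟨ cong (suc (suc n) * d *_) ([1+k]*[1+n]C[1+k]≡[1+n]*nCk n (2 * j)) ⟩
  suc (suc n) * d * (suc n * (n C (2 * j)))
    ≡⟨ regroup₃ (suc (suc n)) d (suc n) _ ⟩
  suc (suc n) * suc n * matchingCount n j ∎
  where
  open ≡-Reasoning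
  d = oddDoubleFactorial j
  regroup₁ : ∀ t d x → suc (suc t) * (suc t * d * x) ≡ d * suc t * (suc (suc t) * x)
  regroup₁ = solve-∀
  regroup₂ : ∀ d s m x → d * s * (m * x) ≡ m * d * (s * x)
  regroup₂ = solve-∀
  regroup₃ : ∀ m d k x → m * d * (k * x) ≡ m * k * (d * x)
  regroup₃ = solve-∀

sumBelow : ℕ → (ℕ → ℕ) → ℕ
sumBelow M f = sum (applyUpTo f M)

syntax sumBelow M (λ j → e) = ∑[ j < M ] e

sumBelow-cong : ∀ M {f g : ℕ → ℕ} → f ≗ g → sumBelow M f ≡ sumBelow M g
sumBelow-cong zero f≗g = refl
sumBelow-cong (suc M) f≗g = cong₂ _+_ (f≗g 0) (sumBelow-cong M (f≗g ∘ suc))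

sumBelow-+ : ∀ M (f g : ℕ → ℕ) → ∑[ j < M ] (f j + g j) ≡ sumBelow M f + sumBelow M g
sumBelow-+ zero f g = refl
sumBelow-+ (suc M) f g = begin
  f 0 + g 0 + ∑[ j < M ] (f (suc j) + g (suc j))
    ≡⟨ cong (f 0 + g 0 +_) (sumBelow-+ M (f ∘ suc) (g ∘ suc)) ⟩
  f 0 + g 0 + (sumBelow M (f ∘ suc) + sumBelow M (g ∘ suc))
    ≡⟨ +-comm-middle (f 0) (g 0) _ _ ⟩
  f 0 + sumBelow M (f ∘ suc) + (g 0 + sumBelow M (g ∘ suc)) ∎
  where
  open ≡-Reasoning
  +-comm-middle : ∀ a b c d → a + b + (c + d) ≡ a + c + (b + d)
  +-comm-middle = solve-∀

sumBelow-* : ∀ M c (f : ℕ → ℕ) → ∑[ j < M ] (c * f j) ≡ c * sumBelow M f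
sumBelow-* zero c f = sym (*-zeroʳ c)
sumBelow-* (suc M) c f =
  trans (cong (c * f 0 +_) (sumBelow-* M c (f ∘ suc))) (sym (*-distribˡ-+ c (f 0) _))

sumBelow-zero : ∀ M {f : ℕ → ℕ} → (∀ j → f j ≡ 0) → sumBelow M f ≡ 0
sumBelow-zero zero _ = refl
sumBelow-zero (suc M) f≡0 = cong₂ _+_ (f≡0 0) (sumBelow-zero M (f≡0 ∘ suc))

module _ (c : ℕ → ℕ) (c0≡1 : c 0 ≡ 1) (c1≡1 : c 1 ≡ 1)
         (recurrence : ∀ n → c (suc (suc n)) ≡ c (suc n) + suc n * c n) where

  -- Terms with j > n / 2 vanish, so any upper bound M with n < 2 M gives the same sum.
  ≡-sumBelow-matchingCount : ∀ n M → n < 2 * M → c n ≡ ∑[ j < M ] matchingCount n j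
  ≡-sumBelow-matchingCount n zero ()
  ≡-sumBelow-matchingCount zero (suc M) _ =
    trans c0≡1 (cong suc (sym (sumBelow-zero M λ j → *-zeroʳ (oddDoubleFactorial (suc j)))))
  ≡-sumBelow-matchingCount (suc zero) (suc M) _ =
    trans c1≡1 (cong suc (sym (sumBelow-zero M λ j →
      trans (matchingCount-suc 1 j) (*-zeroʳ (suc (2 * j) * oddDoubleFactorial j)))))
  ≡-sumBelow-matchingCount (suc (suc n)) (suc M) n+2<2M+2 = begin
    c (suc (suc n))
      ≡⟨ recurrence n ⟩
    c (suc n) + suc n * c n
      ≡⟨ cong₂ (λ x y → x + suc n * y) (≡-sumBelow-matchingCount (suc n) (suc M) n+1<2M+2)
                                       (≡-sumBelow-matchingCount n M n<2M) ⟩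
    suc (sumBelow M (matchingCount (suc n) ∘ suc)) + suc n * sumBelow M (matchingCount n)
      ≡⟨ cong (λ x → suc (sumBelow M (matchingCount (suc n) ∘ suc) + x)) (sumBelow-* M (suc n) (matchingCount n)) ⟨
    suc (sumBelow M (matchingCount (suc n) ∘ suc) + ∑[ j < M ] (suc n * matchingCount n j))
      ≡⟨ cong suc (sumBelow-+ M _ _) ⟨
    suc (∑[ j < M ] (matchingCount (suc n) (suc j) + suc n * matchingCount n j))
      ≡⟨ cong suc (sumBelow-cong M (sym ∘ matchingCount-recurrence n)) ⟩
    suc (sumBelow M (matchingCount (suc (suc n)) ∘ suc)) ∎
    where
    open ≡-Reasoning
    n+3≤2M+2 : suc (suc (suc n)) ≤ suc (suc (2 * M))
    n+3≤2M+2 = subst (suc (suc (suc n)) ≤_) (*-suc 2 M) n+2<2M+2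
    n+1<2M+2 : suc n < 2 * suc M
    n+1<2M+2 = subst (suc (suc n) ≤_) (sym (*-suc 2 M)) (≤-pred (m≤n⇒m≤1+n n+3≤2M+2))
    n<2M : n < 2 * M
    n<2M = ≤-pred (≤-pred n+3≤2M+2)

I₁≡sumBelow-matchingCount : ∀ n M → n < 2 * M → I₁ n ≡ ∑[ j < M ] matchingCount n j
I₁≡sumBelow-matchingCount = ≡-sumBelow-matchingCount I₁ refl refl I₁-recurrence

F-term≡ : ∀ α n j .{{_ : NonZero (j ! * 2 ^ j)}} →
          (2 * j + α) ^ 1 * ((2 * j) ! / (j ! * 2 ^ j)) * (n C (2 * j)) ≡ (2 * j + α) * matchingCount n j
F-term≡ α n j =
  trans (cong (λ d → (2 * j + α) ^ 1 * d * (n C (2 * j))) ([2j]!/[j!*2^j]≡oddDoubleFactorial j))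
        (regroup (2 * j + α) (oddDoubleFactorial j) (n C (2 * j)))
  where
  regroup : ∀ x d b → x * 1 * d * b ≡ x * (d * b)
  regroup = solve-∀

F-as-sumBelow : ∀ α k → F α 1 k ≡ ∑[ j < 2 * k ] ((2 * j + α) * matchingCount (4 * k ∸ 1) j)
F-as-sumBelow α k = trans (cong sum (map-applyUpTo id _ (2 * k)))
  (sumBelow-cong (2 * k) λ j → F-term≡ α (4 * k ∸ 1) j {{m*n≢0 (j !) (2 ^ j) {{j !≢0}} {{m^n≢0 2 j}}}})

sumBelow-weighted : ∀ α n M →
  ∑[ j < suc M ] ((2 * j + α) * matchingCount (suc (suc n)) j)
    ≡ α * ∑[ j < suc M ] matchingCount (suc (suc n)) j + suc (suc n) * suc n * ∑[ j < M ] matchingCount n j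
sumBelow-weighted α n M = begin
  ∑[ j < suc M ] ((2 * j + α) * m j)
    ≡⟨ sumBelow-cong (suc M) (λ j → distribute (2 * j) α (m j)) ⟩
  ∑[ j < suc M ] (α * m j + 2 * j * m j)
    ≡⟨ sumBelow-+ (suc M) (λ j → α * m j) (λ j → 2 * j * m j) ⟩
  ∑[ j < suc M ] (α * m j) + ∑[ j < M ] (2 * suc j * m (suc j))
    ≡⟨ cong₂ _+_ (sumBelow-* (suc M) α m)
                 (sumBelow-cong M ([2+2j]*matchingCount≡[2+n]*[1+n]*matchingCount n)) ⟩
  α * sumBelow (suc M) m + ∑[ j < M ] (suc (suc n) * suc n * matchingCount n j)
    ≡⟨ cong (α * sumBelow (suc M) m +_) (sumBelow-* M (suc (suc n) * suc n) (matchingCount n)) ⟩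
  α * sumBelow (suc M) m + suc (suc n) * suc n * sumBelow M (matchingCount n) ∎
  where
  open ≡-Reasoning
  m = matchingCount (suc (suc n))
  distribute : ∀ x a y → (x + a) * y ≡ a * y + x * y
  distribute = solve-∀

mainTheorem16 : (α k : ℕ) → 1 Data.Nat.≤ k →
    F α 1 k ≡ α * I₁ (4 * k ∸ 1) + 2 * (4 * k ∸ 1) * (2 * k ∸ 1) * I₁ (4 * k ∸ 3)
mainTheorem16 α (suc k) _ = begin
  F α 1 (suc k)
    ≡⟨ F-as-sumBelow α (suc k) ⟩
  ∑[ j < 2 * suc k ] ((2 * j + α) * matchingCount (4 * suc k ∸ 1) j)
    ≡⟨ cong₂ (λ M N → ∑[ j < M ] ((2 * j + α) * matchingCount (N ∸ 1) j)) (*-suc 2 k) (*-suc 4 k) ⟩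
  ∑[ j < 2 + 2 * k ] ((2 * j + α) * matchingCount (3 + 4 * k) j)
    ≡⟨ sumBelow-weighted α (1 + 4 * k) (1 + 2 * k) ⟩
  α * ∑[ j < 2 + 2 * k ] matchingCount (3 + 4 * k) j
    + (3 + 4 * k) * (2 + 4 * k) * ∑[ j < 1 + 2 * k ] matchingCount (1 + 4 * k) j
    ≡⟨ cong₂ (λ x y → α * x + (3 + 4 * k) * (2 + 4 * k) * y)
             (I₁≡sumBelow-matchingCount (3 + 4 * k) (2 + 2 * k) (≤-reflexive (4+4k≡2*[2+2k] k)))
             (I₁≡sumBelow-matchingCount (1 + 4 * k) (1 + 2 * k) (≤-reflexive (2+4k≡2*[1+2k] k))) ⟨
  α * I₁ (3 + 4 * k) + (3 + 4 * k) * (2 + 4 * k) * I₁ (1 + 4 * k)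
    ≡⟨ cong (λ x → α * I₁ (3 + 4 * k) + x * I₁ (1 + 4 * k)) ([3+4k]*[2+4k]≡2*[3+4k]*[1+2k] k) ⟩
  α * I₁ (3 + 4 * k) + 2 * (3 + 4 * k) * (1 + 2 * k) * I₁ (1 + 4 * k)
    ≡⟨ cong₂ (λ N M → α * I₁ (N ∸ 1) + 2 * (N ∸ 1) * (M ∸ 1) * I₁ (N ∸ 3)) (*-suc 4 k) (*-suc 2 k) ⟨
  α * I₁ (4 * suc k ∸ 1) + 2 * (4 * suc k ∸ 1) * (2 * suc k ∸ 1) * I₁ (4 * suc k ∸ 3) ∎
  where
  open ≡-Reasoning
  4+4k≡2*[2+2k] : ∀ k → 4 + 4 * k ≡ 2 * (2 + 2 * k)
  4+4k≡2*[2+2k] = solve-∀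
  2+4k≡2*[1+2k] : ∀ k → 2 + 4 * k ≡ 2 * (1 + 2 * k)
  2+4k≡2*[1+2k] = solve-∀
  [3+4k]*[2+4k]≡2*[3+4k]*[1+2k] : ∀ k → (3 + 4 * k) * (2 + 4 * k) ≡ 2 * (3 + 4 * k) * (1 + 2 * k)
  [3+4k]*[2+4k]≡2*[3+4k]*[1+2k] = solve-∀
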